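{- Let $w$ be a finite word, $\sigma,\tau$ letters and $k\ge 0$ an integer. If $w$ has no $(\sigma,\tau,k)$-rich position, then $w$ has a $(\sigma,\tau,k+1)$-poor position.
   Context: A position of a word is $\sigma$-labeled if it carries the letter $\sigma$. A position $a$ of $w$ is $(\sigma,\tau,k)$-rich if there are at least $k$ $\sigma$-labeled positions strictly before $a$ and at least $k$ $\tau$-labeled positions strictly after $a$. A position $a$ is $(\sigma,\tau,k)$-poor if there are at most $k$ $\sigma$-labeled positions strictly before $a$ and at most $k$ $\tau$-labeled positions strictly after $a$. -}

module Defs where

open import Data.Nat using (ℕ; _≤_)
open import Data.List using (List; length; take; drop; filter)
open import Data.Fin using (Fin; toℕ)
open import Data.Product using (_×_)
open import Relation.Binary.Definitions using (DecidableEquality)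
open import Relation.Binary.PropositionalEquality using (_≡_)

module _ {A : Set} (_≟_ : DecidableEquality A) where

  count : A → List A → ℕ
  count σ u = length (filter (λ x → x ≟ σ) u)

  countBefore : (w : List A) → Fin (length w) → A → ℕ
  countBefore w a σ = count σ (take (toℕ a) w)

  countAfter : (w : List A) → Fin (length w) → A → ℕ
  countAfter w a τ = count τ (drop (ℕ.suc (toℕ a)) w)

  Rich : (w : List A) → A → A → ℕ → Fin (length w) → Set
  Rich w σ τ k a = k ≤ countBefore w a σ × k ≤ countAfter w a τ

  Poor : (w : List A) → A → A → ℕ → Fin (length w) → Set
  Poor w σ τ k a = countBefore w a σ ≤ k × countAfter w a τ ≤ k

-- The position holding the (k+1)-th σ has exactly k σ's before it, so if it is
-- not (σ,τ,k)-rich it has fewer than k τ's after it; if w has at most k σ's,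
-- its last position has at most k σ's before it and no τ after it.  Either way
-- the position is even (σ,τ,k)-poor.

module Submission where

open import Defs
open import Data.Nat using (ℕ; suc; _+_; _≤_; _>_; z≤n)
open import Data.Nat.Properties
  using (≤-trans; ≰⇒≥; m≤n⇒m≤1+n; m≤n⇒m<n∨m≡n; +-assoc; +-comm; +-identityʳ; +-monoʳ-≤)
open import Data.List using (List; []; _∷_; length)
open import Data.List.Properties using (length-filter)
open import Data.Fin using (Fin; zero; suc)
open import Data.Product using (∃; _×_; _,_)
open import Data.Sum using (inj₁; inj₂)
open import Relation.Nullary using (¬_; yes; no)
open import Relation.Binary.Definitions using (DecidableEquality)
open import Relation.Binary.PropositionalEquality using (_≡_; refl; sym; cong; subst; module ≡-Reasoning)

module _ {A : Set} (_≟_ : DecidableEquality A) where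

  count-singleton≤1 : (x σ : A) → count _≟_ σ (x ∷ []) ≤ 1
  count-singleton≤1 x σ = length-filter (λ y → y ≟ σ) (x ∷ [])

  countBefore-suc : (x : A) (w : List A) (a : Fin (length w)) (σ : A) →
    countBefore _≟_ (x ∷ w) (suc a) σ ≡ count _≟_ σ (x ∷ []) + countBefore _≟_ w a σ
  countBefore-suc x w a σ with x ≟ σ
  ... | yes _ = refl
  ... | no _  = refl

  offset-shift : (c : ℕ) (x : A) (w : List A) (a : Fin (length w)) (σ : A) →
    c + countBefore _≟_ (x ∷ w) (suc a) σ ≡ c + count _≟_ σ (x ∷ []) + countBefore _≟_ w a σ
  offset-shift c x w a σ = begin
    c + countBefore _≟_ (x ∷ w) (suc a) σ                   ≡⟨ cong (c +_) (countBefore-suc x w a σ) ⟩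
    c + (count _≟_ σ (x ∷ []) + countBefore _≟_ w a σ)      ≡⟨ sym (+-assoc c _ _) ⟩
    c + count _≟_ σ (x ∷ []) + countBefore _≟_ w a σ        ∎
    where open ≡-Reasoning

  Poor-suc : ∀ w σ τ k a → Poor _≟_ w σ τ k a → Poor _≟_ w σ τ (suc k) a
  Poor-suc _ _ _ _ _ (before≤k , after≤k) = m≤n⇒m≤1+n before≤k , m≤n⇒m≤1+n after≤k

  -- The offset c counts the σ's of a prefix already walked past, so that the
  -- statement can be proved by induction on the remaining suffix.
  noRich⇒poor-offset : (σ τ : A) (k c : ℕ) (x : A) (w : List A) → c ≤ k →
    (∀ a → ¬ (k ≤ c + countBefore _≟_ (x ∷ w) a σ × k ≤ countAfter _≟_ (x ∷ w) a τ)) →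
    ∃ λ a → c + countBefore _≟_ (x ∷ w) a σ ≤ k × countAfter _≟_ (x ∷ w) a τ ≤ k
  noRich⇒poor-offset σ τ k c x [] c≤k noRich =
    zero , subst (_≤ k) (sym (+-identityʳ c)) c≤k , z≤n
  noRich⇒poor-offset σ τ k c x (y ∷ w) c≤k noRich with m≤n⇒m<n∨m≡n c≤k
  ... | inj₂ refl = zero , subst (_≤ c) (sym (+-identityʳ c)) c≤k ,
    ≰⇒≥ (λ k≤after → noRich zero (subst (k ≤_) (sym (+-identityʳ k)) c≤k , k≤after))
  ... | inj₁ c<k
    with noRich⇒poor-offset σ τ k (c + count _≟_ σ (x ∷ [])) y w c+δ≤k
           (λ a (k≤before , k≤after) →
              noRich (suc a) (subst (k ≤_) (sym (offset-shift c x (y ∷ w) a σ)) k≤before , k≤after))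
    where
    c+δ≤k : c + count _≟_ σ (x ∷ []) ≤ k
    c+δ≤k = ≤-trans (+-monoʳ-≤ c (count-singleton≤1 x σ)) (subst (_≤ k) (+-comm 1 c) c<k)
  ... | a , before≤k , after≤k =
    suc a , subst (_≤ k) (sym (offset-shift c x (y ∷ w) a σ)) before≤k , after≤k

  noRich⇒poor : (w : List A) (σ τ : A) (k : ℕ) → length w > 0 →
    (∀ a → ¬ Rich _≟_ w σ τ k a) → ∃ λ a → Poor _≟_ w σ τ k a
  noRich⇒poor (x ∷ w) σ τ k _ noRich = noRich⇒poor-offset σ τ k 0 x w z≤n noRich

mainTheorem2 : {A : Set} (_≟_ : DecidableEquality A) (w : List A) (σ τ : A) (k : ℕ) →
    length w > 0 →
    (∀ (a : Fin (length w)) → ¬ Rich _≟_ w σ τ k a) →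
    ∃ λ (a : Fin (length w)) → Poor _≟_ w σ τ (suc k) a
mainTheorem2 _≟_ w σ τ k nonempty noRich with noRich⇒poor _≟_ w σ τ k nonempty noRich
... | a , poor = a , Poor-suc _≟_ w σ τ k a poor
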